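{- Let $N\ge2$, let $\ell$ be an integer and $1\le x\le N-1$. The number of permutations of $\{1,\dots,N-1\}$ with exactly $\ell-1$ special descents and last entry $x$ equals $R(N,\ell,x)$.
   Context: For a permutation $\sigma=\sigma_1\cdots\sigma_n$ of $\{1,\dots,n\}$, a descent is a position $1\le i<n$ with $\sigma_i>\sigma_{i+1}$; a special descent is either a descent $i\ge1$, or the index $i=0$ in the case $\sigma_1=1$. A recursive tree on $N$ vertices is a tree with vertices labeled $0,\dots,N-1$, rooted at $0$, with labels strictly increasing along every path from the root. Its smallest rooted path starts at the root and at each vertex proceeds to the child with smallest label until reaching a vertex with no children. $R(N,\ell,x)$ is the number of recursive trees on $N$ vertices with exactly $\ell$ vertices of degree $1$ (the root counts if it has degree $1$) whose smallest rooted path ends at vertex $x$. -}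

module Defs where

open import Data.Bool using (Bool; true; false; if_then_else_; _∧_; not)
open import Data.Nat using (ℕ; zero; suc; _+_; _∸_; _≡ᵇ_; _<ᵇ_)
open import Data.List using (List; []; _∷_; _++_; map; concatMap; length; filterᵇ; upTo; applyUpTo; last; all)
open import Data.Maybe using (Maybe; just; nothing)
open import Data.Integer using (ℤ; +_; _-_)
import Data.Integer as ℤ
open import Relation.Nullary.Decidable using (⌊_⌋)

allLists : ℕ → List ℕ → List (List ℕ)
allLists zero    s = [] ∷ []
allLists (suc k) s = concatMap (λ a → map (a ∷_) (allLists k s)) s

oneTo : ℕ → List ℕ
oneTo n = applyUpTo suc n

countᵇ : {A : Set} → (A → Bool) → List A → ℕ
countᵇ p xs = length (filterᵇ p xs)

elemᵇ : ℕ → List ℕ → Bool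
elemᵇ a []       = false
elemᵇ a (b ∷ bs) = if a ≡ᵇ b then true else elemᵇ a bs

distinctᵇ : List ℕ → Bool
distinctᵇ []       = true
distinctᵇ (a ∷ as) = not (elemᵇ a as) ∧ distinctᵇ as

perms : ℕ → List (List ℕ)
perms n = filterᵇ distinctᵇ (allLists n (oneTo n))

descents : List ℕ → ℕ
descents (a ∷ b ∷ rest) = (if b <ᵇ a then 1 else 0) + descents (b ∷ rest)
descents _              = 0

-- special descents: the descents, plus the index 0 when σ₁ = 1
specialDescents : List ℕ → ℕ
specialDescents []       = 0
specialDescents (a ∷ as) = (if a ≡ᵇ 1 then 1 else 0) + descents (a ∷ as)

lastIs : ℕ → List ℕ → Bool
lastIs x σ with last σ
... | just y  = y ≡ᵇ x
... | nothing = false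

_≡ℤᵇ_ : ℤ → ℤ → Bool
i ≡ℤᵇ j = ⌊ i ℤ.≟ j ⌋

permCount : ℕ → ℤ → ℕ → ℕ
permCount n ℓ x =
  countᵇ (λ σ → ((+ specialDescents σ) ≡ℤᵇ (ℓ - + 1)) ∧ lastIs x σ) (perms n)

-- Recursive trees on N vertices {0,...,N-1}, rooted at 0, labels
-- increasing away from the root.  Such a tree is exactly determined by
-- its parent map, with parent(v) ∈ {0,...,v-1} for v = 1..N-1.  We encode
-- a tree as the list [parent(1), parent(2), ..., parent(N-1)].

parentLists : ℕ → List (List ℕ)
parentLists zero    = [] ∷ []
parentLists (suc m) =
  concatMap (λ ps → map (λ p → ps ++ (p ∷ [])) (upTo (suc m))) (parentLists m)

recursiveTrees : ℕ → List (List ℕ)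
recursiveTrees N = parentLists (N ∸ 1)

children : List ℕ → ℕ → ℕ
children ps v = countᵇ (λ p → p ≡ᵇ v) ps

-- degree of v in the tree on N vertices (root has no parent edge)
degree : List ℕ → ℕ → ℕ
degree ps zero    = children ps zero
degree ps (suc v) = suc (children ps (suc v))

leaves : ℕ → List ℕ → ℕ
leaves N ps = countᵇ (λ v → degree ps v ≡ᵇ 1) (upTo N)

-- the child of v with smallest label, if any: the first index i
-- (vertex i+1) in the parent list with parent v
smallestChildFrom : ℕ → List ℕ → ℕ → Maybe ℕ
smallestChildFrom u []       v = nothing
smallestChildFrom u (p ∷ ps) v =
  if p ≡ᵇ v then just u else smallestChildFrom (suc u) ps v

smallestChild : List ℕ → ℕ → Maybe ℕ
smallestChild ps v = smallestChildFrom 1 ps v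

-- follow smallest children starting from v, with fuel (labels strictly
-- increase along the path, so fuel N suffices for a tree on N vertices)
pathEnd : ℕ → List ℕ → ℕ → ℕ
pathEnd zero       ps v = v
pathEnd (suc fuel) ps v with smallestChild ps v
... | nothing = v
... | just u  = pathEnd fuel ps u

smallestPathEnd : ℕ → List ℕ → ℕ
smallestPathEnd N ps = pathEnd N ps 0

R : ℕ → ℤ → ℕ → ℕ
R N ℓ x =
  countᵇ (λ ps → ((+ leaves N ps) ≡ℤᵇ ℓ) ∧ (smallestPathEnd N ps ≡ᵇ x))
         (recursiveTrees N)

-- Both families are produced by the same generating rule.  Every permutation of {1,…,n+1}
-- arises exactly once by inserting n+1 into one of the n+1 slots of a permutation of
-- {1,…,n}, and every recursive tree on n+2 vertices arises exactly once by attaching the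
-- vertex n+1 to one of the vertices 0,…,n of a recursive tree on n+1 vertices.  Record the
-- pair (number of special descents + 1, last entry) of a permutation and the pair (number
-- of leaves, end of the smallest rooted path) of a tree.  If the parent has pair (ℓ, x),
-- exactly ℓ of the n+1 choices keep ℓ: inserting at the end or right after σᵢ for a special
-- descent i (at the front when i = 0), resp. attaching to a leaf.  Among them, inserting at
-- the end, resp. attaching to the leaf x, gives (ℓ, n+1); the other ℓ-1 give (ℓ, x); the
-- remaining n+1-ℓ choices give (ℓ+1, x).  Both families start with the single pair (2, 1),
-- so by induction the multisets of pairs agree in every size, and hence so do the counts.

module Submission where

open import Data.Bool using (Bool; true; false; if_then_else_; not; T; T?; _∧_)
open import Data.Bool.Properties using (T-≡)
open import Data.Integer as ℤ using (ℤ)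
import Data.Integer.Properties as ℤ
open import Data.List
  using (List; []; _∷_; _++_; [_]; map; concatMap; length; upTo; applyUpTo; replicate; last)
open import Data.List.Properties
  using (map-++; map-∘; map-upTo; map-cong-local; map-concatMap; concatMap-map; length-upTo; length-applyUpTo;
         length-++; upTo-∷ʳ; applyUpTo-∷ʳ; ++-assoc; ++-identityʳ; ∷-injective)
open import Data.List.Membership.Propositional using (_∈_; _∉_; find; lose)
open import Data.List.Membership.Propositional.Properties
  using (∈-map⁺; ∈-map⁻; ∈-concatMap⁺; ∈-concatMap⁻; ∈-filter⁺; ∈-filter⁻; ∈-applyUpTo⁺; ∈-applyUpTo⁻;
         ∈-upTo⁻; ∈-∃++; ∈-++⁻; ∈-++⁺ˡ; ∈-++⁺ʳ)
open import Data.List.Membership.Propositional.Properties.WithK using (unique∧set⇒bag)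
open import Data.List.Relation.Binary.BagAndSetEquality using (∼bag⇒↭)
open import Data.List.Relation.Binary.Permutation.Propositional
  using (_↭_; prep; swap; ↭-refl; ↭-sym; ↭-trans; ↭-reflexive; ↭⇒↭ₛ; module PermutationReasoning)
  renaming (refl to ↭-id; trans to ↭-comp)
open import Data.List.Relation.Binary.Permutation.Propositional.Properties
  using (++⁺ˡ; ++⁺; ++-comm; shift; map⁺; drop-mid; ∈-resp-↭; All-resp-↭; ↭-length; ∷↭∷ʳ)
import Data.List.Relation.Binary.Permutation.Setoid.Properties as ↭ₛ
open import Data.List.Relation.Unary.All as All using (All; []; _∷_)
import Data.List.Relation.Unary.All.Properties as All
open import Data.List.Relation.Unary.Any using (here; there)
open import Data.List.Relation.Unary.Unique.Propositional using (Unique; []; _∷_)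
import Data.List.Relation.Unary.Unique.Propositional.Properties as Unique
open import Data.Maybe using (just; nothing; _<∣>_; fromMaybe)
open import Data.Nat using (ℕ; zero; suc; _+_; _∸_; _≡ᵇ_; _<ᵇ_; _≤_; _<_; z≤n; s≤s)
open import Data.Nat.ListAction using (sum)
open import Data.Nat.ListAction.Properties using (sum-++; sum-↭)
open import Data.Nat.Properties
open import Algebra.Properties.CommutativeSemigroup +-commutativeSemigroup using (x∙yz≈y∙xz)
open import Data.Product using (∃; ∃₂; _×_; _,_; proj₁; proj₂)
open import Data.Sum using (inj₁; inj₂)
open import Data.Unit using (⊤; tt)
open import Function using (_∘_)
open import Function.Bundles using (_⇔_; mk⇔; Equivalence)
open import Relation.Binary.PropositionalEquality hiding ([_])
open import Relation.Nullary using (¬_; contradiction)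
open import Relation.Nullary.Decidable using (does; isYes; does-⇔; isYes≗does)

open import Defs

<ᵇ-true : {a m : ℕ} → a < m → (a <ᵇ m) ≡ true
<ᵇ-true a<m = Equivalence.to T-≡ (<⇒<ᵇ a<m)

<ᵇ-false : {a m : ℕ} → a < m → (m <ᵇ a) ≡ false
<ᵇ-false {a} {m} a<m with m <ᵇ a in m<ᵇa
... | false = refl
... | true  = contradiction (<ᵇ⇒< m a (subst T (sym m<ᵇa) _)) (<⇒≯ a<m)

≡ᵇ-true⇒≡ : (a b : ℕ) → (a ≡ᵇ b) ≡ true → a ≡ b
≡ᵇ-true⇒≡ a b a≡b = ≡ᵇ⇒≡ a b (subst T (sym a≡b) _)

≡ᵇ-sym : (a b : ℕ) → (a ≡ᵇ b) ≡ (b ≡ᵇ a)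
≡ᵇ-sym zero    zero    = refl
≡ᵇ-sym zero    (suc b) = refl
≡ᵇ-sym (suc a) zero    = refl
≡ᵇ-sym (suc a) (suc b) = ≡ᵇ-sym a b

<⇒≡ᵇ-false : {a b : ℕ} → a < b → (a ≡ᵇ b) ≡ false
<⇒≡ᵇ-false {a} {b} a<b with a ≡ᵇ b in a≡?b
... | false = refl
... | true  = contradiction (≡ᵇ-true⇒≡ a b a≡?b) (<⇒≢ a<b)

count : {A : Set} → (A → Bool) → List A → ℕ
count p xs = sum (map (λ a → if p a then 1 else 0) xs)

countᵇ≡count : {A : Set} (p : A → Bool) (xs : List A) → countᵇ p xs ≡ count p xs
countᵇ≡count p []       = refl
countᵇ≡count p (x ∷ xs) with p x
... | true  = cong suc (countᵇ≡count p xs)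
... | false = countᵇ≡count p xs

count-++ : {A : Set} (p : A → Bool) (xs ys : List A) → count p (xs ++ ys) ≡ count p xs + count p ys
count-++ p xs ys = trans (cong sum (map-++ _ xs ys)) (sum-++ (map _ xs) _)

count-↭ : {A : Set} (p : A → Bool) {xs ys : List A} → xs ↭ ys → count p xs ≡ count p ys
count-↭ p xs↭ys = sum-↭ (map⁺ _ xs↭ys)

count-map : {A B : Set} (p : B → Bool) (f : A → B) (xs : List A) → count p (map f xs) ≡ count (λ a → p (f a)) xs
count-map p f xs = cong sum (sym (map-∘ xs))

count-cong : {A : Set} {p q : A → Bool} → (∀ a → p a ≡ q a) → (xs : List A) → count p xs ≡ count q xs
count-cong p≗q []       = refl
count-cong p≗q (x ∷ xs) = cong₂ (λ b n → (if b then 1 else 0) + n) (p≗q x) (count-cong p≗q xs)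

count+count-not : {A : Set} (p : A → Bool) (xs : List A) → count p xs + count (λ a → not (p a)) xs ≡ length xs
count+count-not p []       = refl
count+count-not p (x ∷ xs) with p x
... | true  = cong suc (count+count-not p xs)
... | false = trans (+-suc _ _) (cong suc (count+count-not p xs))

count-upTo-suc : (q : ℕ → Bool) (n : ℕ) →
  count q (upTo (suc n)) ≡ (if q 0 then 1 else 0) + count (λ i → q (suc i)) (upTo n)
count-upTo-suc q n =
  cong ((if q 0 then 1 else 0) +_) (trans (cong (count q) (sym (map-upTo suc n))) (count-map q suc (upTo n)))

count-upTo-≡ᵇ : (c n : ℕ) → c < n → count (_≡ᵇ c) (upTo n) ≡ 1
count-upTo-≡ᵇ zero (suc n) _ = trans (count-upTo-suc (_≡ᵇ 0) n) (cong suc (no-zero n))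
  where
    no-zero : (n : ℕ) → count (λ i → suc i ≡ᵇ 0) (upTo n) ≡ 0
    no-zero zero    = refl
    no-zero (suc n) = trans (count-upTo-suc (λ i → suc i ≡ᵇ 0) n) (no-zero n)
count-upTo-≡ᵇ (suc c) (suc n) (s≤s c<n) = trans (count-upTo-suc (_≡ᵇ suc c) n) (count-upTo-≡ᵇ c n c<n)

count-≡ᵇ-pos : (c : ℕ) (q : ℕ → Bool) (xs : List ℕ) → count (_≡ᵇ c) xs ≡ 1 → q c ≡ true →
  1 ≤ count q xs
count-≡ᵇ-pos c q (y ∷ xs) once qc with y ≡ᵇ c in y≡c | q y in qy
... | _     | true  = s≤s z≤n
... | false | false = count-≡ᵇ-pos c q xs once qc
... | true  | false with () ← trans (sym qc) (subst (λ z → q z ≡ false) (≡ᵇ-true⇒≡ y c y≡c) qy)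

count-≡ᵇ-absent : (c : ℕ) (xs : List ℕ) → All (_< c) xs → count (_≡ᵇ c) xs ≡ 0
count-≡ᵇ-absent c []       []           = refl
count-≡ᵇ-absent c (y ∷ xs) (y<c ∷ xs<c) rewrite <⇒≡ᵇ-false y<c = count-≡ᵇ-absent c xs xs<c

count-avoiding : (c : ℕ) (q : ℕ → Bool) (xs : List ℕ) → count (_≡ᵇ c) xs ≡ 0 →
  count (λ v → not (v ≡ᵇ c) ∧ q v) xs ≡ count q xs
count-avoiding c q []       _    = refl
count-avoiding c q (y ∷ xs) none with y ≡ᵇ c
... | false = cong ((if q y then 1 else 0) +_) (count-avoiding c q xs none)

count-avoiding-once : (c : ℕ) (q : ℕ → Bool) (xs : List ℕ) → count (_≡ᵇ c) xs ≡ 1 →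
  count (λ v → not (v ≡ᵇ c) ∧ q v) xs + (if q c then 1 else 0) ≡ count q xs
count-avoiding-once c q (y ∷ xs) once with y ≡ᵇ c in y≡?c
... | true rewrite ≡ᵇ-true⇒≡ y c y≡?c =
  trans (+-comm _ (if q c then 1 else 0)) (cong ((if q c then 1 else 0) +_) (count-avoiding c q xs (suc-injective once)))
... | false = trans (+-assoc (if q y then 1 else 0) _ _) (cong ((if q y then 1 else 0) +_) (count-avoiding-once c q xs once))

≡ᵇ1-after-increment : (b : Bool) (d : ℕ) → 1 ≤ d → ((if b then 1 else 0) + d ≡ᵇ 1) ≡ (not b ∧ (d ≡ᵇ 1))
≡ᵇ1-after-increment true  (suc d) _ = refl
≡ᵇ1-after-increment false d       _ = refl

Unique-resp-↭ : {A : Set} {xs ys : List A} → xs ↭ ys → Unique xs → Unique ys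
Unique-resp-↭ {A} p = ↭ₛ.Unique-resp-↭ (setoid A) (↭⇒↭ₛ p)

Unique⇒∃++↭ : {A : Set} {xs ys : List A} → Unique xs → All (_∈ ys) xs → ∃ λ zs → xs ++ zs ↭ ys
Unique⇒∃++↭ {ys = ys} []            []          = ys , ↭-refl
Unique⇒∃++↭ {ys = ys} (x∉xs ∷ uxs) (x∈ys ∷ xs⊆) with ∈-∃++ x∈ys
... | as , bs , refl with Unique⇒∃++↭ uxs (All.zipWith shrink (x∉xs , xs⊆))
  where
    shrink : ∀ {y} → _ ≢ y × y ∈ as ++ [ _ ] ++ bs → y ∈ as ++ bs
    shrink {y} (x≢y , y∈) with ∈-++⁻ as y∈
    ... | inj₁ y∈as         = ∈-++⁺ˡ y∈as
    ... | inj₂ (here y≡x)   = contradiction (sym y≡x) x≢y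
    ... | inj₂ (there y∈bs) = ∈-++⁺ʳ as y∈bs
... | zs , xs++zs↭ = zs , ↭-trans (prep _ xs++zs↭) (↭-sym (shift _ as bs))

Unique-concatMap⁺ : {A B : Set} (f : A → List B) {xs : List A} → Unique xs → All (λ x → Unique (f x)) xs →
  (∀ {x y v} → x ∈ xs → y ∈ xs → v ∈ f x → v ∈ f y → x ≡ y) → Unique (concatMap f xs)
Unique-concatMap⁺ f []             []        _       = []
Unique-concatMap⁺ f {x ∷ xs} (x∉xs ∷ uxs) (ufx ∷ ufs) joint =
  Unique.++⁺ ufx (Unique-concatMap⁺ f uxs ufs λ x∈ y∈ → joint (there x∈) (there y∈)) disjoint
  where
    disjoint : ∀ {v} → ¬ (v ∈ f x × v ∈ concatMap f xs)
    disjoint (v∈fx , v∈rest) with find (∈-concatMap⁻ f v∈rest)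
    ... | y , y∈xs , v∈fy = All.lookup x∉xs y∈xs (joint (here refl) (there y∈xs) v∈fx v∈fy)

concatMap⁺ : {A B : Set} (f : A → List B) {xs ys : List A} → xs ↭ ys → concatMap f xs ↭ concatMap f ys
concatMap⁺ f ↭-id           = ↭-refl
concatMap⁺ f (prep x p)     = ++⁺ˡ (f x) (concatMap⁺ f p)
concatMap⁺ f (swap x y p)   =
  ↭-trans (↭-reflexive (sym (++-assoc (f x) (f y) _)))
    (↭-trans (++⁺ (++-comm (f x) (f y)) (concatMap⁺ f p)) (↭-reflexive (++-assoc (f y) (f x) _)))
concatMap⁺ f (↭-comp p q)  = ↭-trans (concatMap⁺ f p) (concatMap⁺ f q)

concatMap-cong-local : {A B : Set} {f g : A → List B} {xs : List A} → All (λ a → f a ↭ g a) xs →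
  concatMap f xs ↭ concatMap g xs
concatMap-cong-local []           = ↭-refl
concatMap-cong-local (fx↭gx ∷ rest) = ++⁺ fx↭gx (concatMap-cong-local rest)

module _ {B : Set} (top keep raise : B) (c : ℕ) (q : ℕ → Bool) where

  classify : ℕ → B
  classify i = if i ≡ᵇ c then top else if q i then keep else raise

  map-classify-∌ : (xs : List ℕ) → count (_≡ᵇ c) xs ≡ 0 →
    map classify xs ↭ replicate (count q xs) keep ++ replicate (count (λ i → not (q i)) xs) raise
  map-classify-∌ []       _    = ↭-refl
  map-classify-∌ (y ∷ xs) none with y ≡ᵇ c | q y
  ... | false | true  = prep keep (map-classify-∌ xs none)
  ... | false | false =
    ↭-trans (prep raise (map-classify-∌ xs none)) (↭-sym (shift raise (replicate (count q xs) keep) _))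

  map-classify-∋ : (xs : List ℕ) → count (_≡ᵇ c) xs ≡ 1 → q c ≡ true →
    map classify xs ↭ top ∷ replicate (count q xs ∸ 1) keep ++ replicate (count (λ i → not (q i)) xs) raise
  map-classify-∋ (y ∷ xs) once qc with y ≡ᵇ c in y≡c
  ... | true rewrite ≡ᵇ-true⇒≡ y c y≡c | qc = prep top (map-classify-∌ xs (suc-injective once))
  ... | false with q y
  ...   | false = ↭-trans (prep raise (map-classify-∋ xs once qc)) (↭-trans (swap raise top ↭-refl)
                    (prep top (↭-sym (shift raise (replicate (count q xs ∸ 1) keep) _))))
  ...   | true  = ↭-trans (prep keep (map-classify-∋ xs once qc)) (↭-trans (swap keep top ↭-refl)
                    (prep top (↭-reflexive (cong (λ k → replicate k keep ++ raises)
                      (m+[n∸m]≡n (count-≡ᵇ-pos c q xs once qc))))))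
    where raises = replicate (count (λ i → not (q i)) xs) raise

offspring : ℕ → ℕ × ℕ → List (ℕ × ℕ)
offspring m (ℓ , x) = (ℓ , m) ∷ replicate (ℓ ∸ 1) (ℓ , x) ++ replicate (m ∸ ℓ) (suc ℓ , x)

map-classify-upTo↭offspring : (m ℓ x c : ℕ) (q : ℕ → Bool) → c < m → q c ≡ true → count q (upTo m) ≡ ℓ →
  map (classify (ℓ , m) (ℓ , x) (suc ℓ , x) c q) (upTo m) ↭ offspring m (ℓ , x)
map-classify-upTo↭offspring m ℓ x c q c<m qc ℓ-keep =
  ↭-trans (map-classify-∋ _ _ _ c q (upTo m) (count-upTo-≡ᵇ c m c<m) qc)
          (↭-reflexive (cong₂ (λ k r → (ℓ , m) ∷ replicate (k ∸ 1) (ℓ , x) ++ replicate r (suc ℓ , x))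
                              ℓ-keep raises))
  where
    raises : count (λ i → not (q i)) (upTo m) ≡ m ∸ ℓ
    raises = begin
      count (λ i → not (q i)) (upTo m)
        ≡⟨ m+n∸m≡n (count q (upTo m)) _ ⟨
      count q (upTo m) + count (λ i → not (q i)) (upTo m) ∸ count q (upTo m)
        ≡⟨ cong₂ _∸_ (trans (count+count-not q (upTo m)) (length-upTo m)) ℓ-keep ⟩
      m ∸ ℓ
        ∎
      where open ≡-Reasoning

↭-of-same-rule : {B : Set} (rule : ℕ → B → List B) (s t : ℕ → List B) → s 0 ↭ t 0 →
  (∀ k → s (suc k) ↭ concatMap (rule k) (s k)) → (∀ k → t (suc k) ↭ concatMap (rule k) (t k)) →
  ∀ k → s k ↭ t k
↭-of-same-rule rule s t base s-step t-step zero    = base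
↭-of-same-rule rule s t base s-step t-step (suc k) =
  ↭-trans (s-step k)
    (↭-trans (concatMap⁺ (rule k) (↭-of-same-rule rule s t base s-step t-step k)) (↭-sym (t-step k)))

elemᵇ⇒∈ : (a : ℕ) (bs : List ℕ) → T (elemᵇ a bs) → a ∈ bs
elemᵇ⇒∈ a (b ∷ bs) t with a ≡ᵇ b in a≡b
... | true  = here (≡ᵇ-true⇒≡ a b a≡b)
... | false = there (elemᵇ⇒∈ a bs t)

∈⇒elemᵇ : (a : ℕ) (bs : List ℕ) → a ∈ bs → T (elemᵇ a bs)
∈⇒elemᵇ a (b ∷ bs) a∈ with a ≡ᵇ b in a≡b | a∈
... | true  | _           = _
... | false | here refl   = contradiction (≡⇒≡ᵇ a a refl) (subst T a≡b)
... | false | there a∈bs  = ∈⇒elemᵇ a bs a∈bs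

distinctᵇ⇒Unique : (σ : List ℕ) → T (distinctᵇ σ) → Unique σ
distinctᵇ⇒Unique []      _ = []
distinctᵇ⇒Unique (a ∷ σ) t with elemᵇ a σ in a∈?σ
... | false = All.¬Any⇒All¬ σ (λ a∈σ → subst T a∈?σ (∈⇒elemᵇ a σ a∈σ)) ∷ distinctᵇ⇒Unique σ t

Unique⇒distinctᵇ : (σ : List ℕ) → Unique σ → T (distinctᵇ σ)
Unique⇒distinctᵇ []      _            = _
Unique⇒distinctᵇ (a ∷ σ) (a∉σ ∷ uσ) with elemᵇ a σ in a∈?σ
... | false = Unique⇒distinctᵇ σ uσ
... | true  = Unique.Unique[x∷xs]⇒x∉xs (a∉σ ∷ uσ) (elemᵇ⇒∈ a σ (subst T (sym a∈?σ) _))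

allLists-∈⁻ : (k : ℕ) (s : List ℕ) {σ : List ℕ} → σ ∈ allLists k s → length σ ≡ k × All (_∈ s) σ
allLists-∈⁻ zero    s (here refl) = refl , []
allLists-∈⁻ (suc k) s σ∈ with find (∈-concatMap⁻ (λ a → map (a ∷_) (allLists k s)) {xs = s} σ∈)
... | a , a∈s , σ∈′ with ∈-map⁻ (a ∷_) σ∈′
... | τ , τ∈ , refl with allLists-∈⁻ k s τ∈
... | length-τ , τ⊆s = cong suc length-τ , a∈s ∷ τ⊆s

allLists-∈⁺ : (k : ℕ) (s σ : List ℕ) → length σ ≡ k → All (_∈ s) σ → σ ∈ allLists k s
allLists-∈⁺ zero    s []      _      _             = here refl
allLists-∈⁺ (suc k) s (b ∷ σ) length-σ (b∈s ∷ σ⊆s) =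
  ∈-concatMap⁺ (λ a → map (a ∷_) (allLists k s)) {xs = s}
    (lose b∈s (∈-map⁺ (b ∷_) (allLists-∈⁺ k s σ (suc-injective length-σ) σ⊆s)))

Unique-allLists : (k : ℕ) (s : List ℕ) → Unique s → Unique (allLists k s)
Unique-allLists zero    s _  = [] ∷ []
Unique-allLists (suc k) s us =
  Unique-concatMap⁺ (λ a → map (a ∷_) (allLists k s)) us
    (All.tabulate (λ _ → Unique.map⁺ (λ e → proj₂ (∷-injective e)) (Unique-allLists k s us)))
    same-head
  where
    same-head : ∀ {a b v} → a ∈ s → b ∈ s →
      v ∈ map (a ∷_) (allLists k s) → v ∈ map (b ∷_) (allLists k s) → a ≡ b
    same-head _ _ v∈a v∈b with ∈-map⁻ (_ ∷_) v∈a | ∈-map⁻ (_ ∷_) v∈b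
    ... | _ , _ , refl | _ , _ , e = proj₁ (∷-injective e)

Unique-oneTo : (n : ℕ) → Unique (oneTo n)
Unique-oneTo n = Unique.applyUpTo⁺₁ suc n (λ i<j _ e → <⇒≢ i<j (suc-injective e))

oneTo-∷ʳ : (n : ℕ) → oneTo n ++ [ suc n ] ≡ oneTo (suc n)
oneTo-∷ʳ n = applyUpTo-∷ʳ suc n

oneTo-< : (n : ℕ) → All (_< suc n) (oneTo n)
oneTo-< n = All.tabulate λ y∈ → let i , i<n , y≡ = ∈-applyUpTo⁻ suc y∈ in subst (_< suc n) (sym y≡) (s≤s i<n)

∈-perms⁻ : (n : ℕ) {σ : List ℕ} → σ ∈ perms n → σ ↭ oneTo n
∈-perms⁻ n {σ} σ∈ with ∈-filter⁻ (λ σ → T? (distinctᵇ σ)) σ∈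
... | σ∈all , distinct with allLists-∈⁻ n (oneTo n) σ∈all
... | length-σ , σ⊆ with Unique⇒∃++↭ (distinctᵇ⇒Unique σ distinct) σ⊆
... | [] , σ↭ = ↭-trans (↭-reflexive (sym (++-identityʳ σ))) σ↭
... | z ∷ zs , σ++zs↭ = contradiction (+-cancelˡ-≡ n _ _ lengths) λ ()
  where
    lengths : n + length (z ∷ zs) ≡ n + 0
    lengths = begin
      n + length (z ∷ zs)        ≡⟨ cong (_+ _) length-σ ⟨
      length σ + length (z ∷ zs) ≡⟨ length-++ σ ⟨
      length (σ ++ z ∷ zs)       ≡⟨ ↭-length σ++zs↭ ⟩
      length (oneTo n)           ≡⟨ length-applyUpTo suc n ⟩
      n                          ≡⟨ +-identityʳ n ⟨
      n + 0                      ∎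
      where open ≡-Reasoning

∈-perms⁺ : (n : ℕ) {σ : List ℕ} → σ ↭ oneTo n → σ ∈ perms n
∈-perms⁺ n {σ} σ↭ =
  ∈-filter⁺ (λ σ → T? (distinctᵇ σ))
    (allLists-∈⁺ n (oneTo n) σ (trans (↭-length σ↭) (length-applyUpTo suc n)) (All.tabulate (∈-resp-↭ σ↭)))
    (Unique⇒distinctᵇ σ (Unique-resp-↭ (↭-sym σ↭) (Unique-oneTo n)))

Unique-perms : (n : ℕ) → Unique (perms n)
Unique-perms n = Unique.filter⁺ (λ σ → T? (distinctᵇ σ)) (Unique-allLists n (oneTo n) (Unique-oneTo n))

insertAt : ℕ → ℕ → List ℕ → List ℕ
insertAt zero    m τ       = m ∷ τ
insertAt (suc i) m []      = m ∷ []
insertAt (suc i) m (a ∷ τ) = a ∷ insertAt i m τ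

insertions : ℕ → List ℕ → List (List ℕ)
insertions m τ = applyUpTo (λ i → insertAt i m τ) (suc (length τ))

insertAt↭ : (i m : ℕ) (τ : List ℕ) → insertAt i m τ ↭ m ∷ τ
insertAt↭ zero    m τ       = ↭-refl
insertAt↭ (suc i) m []      = ↭-refl
insertAt↭ (suc i) m (a ∷ τ) = ↭-trans (prep a (insertAt↭ i m τ)) (swap a m ↭-refl)

insertAt-length : (m : ℕ) (as bs : List ℕ) → insertAt (length as) m (as ++ bs) ≡ as ++ m ∷ bs
insertAt-length m []       bs = refl
insertAt-length m (a ∷ as) bs = cong (a ∷_) (insertAt-length m as bs)

insertAt-injective : {i j m : ℕ} (τ τ′ : List ℕ) → m ∉ τ → m ∉ τ′ → i ≤ length τ → j ≤ length τ′ →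
  insertAt i m τ ≡ insertAt j m τ′ → i ≡ j × τ ≡ τ′
insertAt-injective {zero}  {zero}  τ τ′ _ _ _ _ e = refl , proj₂ (∷-injective e)
insertAt-injective {zero}  {suc j} τ (b ∷ τ′) _ m∉τ′ _ _ e =
  contradiction (here (proj₁ (∷-injective e))) m∉τ′
insertAt-injective {suc i} {zero}  (a ∷ τ) τ′ m∉τ _ _ _ e =
  contradiction (here (sym (proj₁ (∷-injective e)))) m∉τ
insertAt-injective {suc i} {suc j} (a ∷ τ) (b ∷ τ′) m∉τ m∉τ′ (s≤s i≤) (s≤s j≤) e
  with a≡b , e′ ← ∷-injective e
  with i≡j , τ≡τ′ ← insertAt-injective τ τ′ (m∉τ ∘ there) (m∉τ′ ∘ there) i≤ j≤ e′ =
  cong suc i≡j , cong₂ _∷_ a≡b τ≡τ′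

suc∉ : (n : ℕ) {τ : List ℕ} → τ ↭ oneTo n → suc n ∉ τ
suc∉ n τ↭ m∈τ = <-irrefl refl (All.lookup (All-resp-↭ (↭-sym τ↭) (oneTo-< n)) m∈τ)

∈-insertions : (m : ℕ) (τ : List ℕ) {i : ℕ} → i ≤ length τ → insertAt i m τ ∈ insertions m τ
∈-insertions m τ i≤ = ∈-applyUpTo⁺ (λ i → insertAt i m τ) (s≤s i≤)

Unique-insertions : (m : ℕ) (τ : List ℕ) → m ∉ τ → Unique (insertions m τ)
Unique-insertions m τ m∉τ = Unique.applyUpTo⁺₁ _ (suc (length τ)) λ i<j j≤ e →
  <⇒≢ i<j (proj₁ (insertAt-injective τ τ m∉τ m∉τ (≤-pred (<-trans i<j j≤)) (≤-pred j≤) e))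

insertAt-↭oneTo : (i n : ℕ) {τ : List ℕ} → τ ↭ oneTo n → insertAt i (suc n) τ ↭ oneTo (suc n)
insertAt-↭oneTo i n {τ} τ↭ = begin
  insertAt i (suc n) τ    ↭⟨ insertAt↭ i (suc n) τ ⟩
  suc n ∷ τ               ↭⟨ prep (suc n) τ↭ ⟩
  suc n ∷ oneTo n         ↭⟨ ∷↭∷ʳ (suc n) (oneTo n) ⟩
  oneTo n ++ [ suc n ]    ≡⟨ oneTo-∷ʳ n ⟩
  oneTo (suc n)           ∎
  where open PermutationReasoning

↭oneTo-suc⇒insertAt : (n : ℕ) {σ : List ℕ} → σ ↭ oneTo (suc n) →
  ∃₂ λ i τ → τ ↭ oneTo n × i ≤ length τ × σ ≡ insertAt i (suc n) τ
↭oneTo-suc⇒insertAt n σ↭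
  with ∈-∃++ (∈-resp-↭ (↭-sym σ↭) (subst (suc n ∈_) (oneTo-∷ʳ n) (∈-++⁺ʳ (oneTo n) (here refl))))
... | as , bs , refl =
  length as , as ++ bs , τ↭ , subst (length as ≤_) (sym (length-++ as)) (m≤m+n _ _) ,
  sym (insertAt-length (suc n) as bs)
  where
    τ↭ : as ++ bs ↭ oneTo n
    τ↭ = ↭-trans (drop-mid as (oneTo n) (subst (as ++ [ suc n ] ++ bs ↭_) (sym (oneTo-∷ʳ n)) σ↭))
                 (↭-reflexive (++-identityʳ (oneTo n)))

perms-suc↭ : (n : ℕ) → perms (suc n) ↭ concatMap (insertions (suc n)) (perms n)
perms-suc↭ n = ∼bag⇒↭ (unique∧set⇒bag (Unique-perms (suc n)) unique-insertions (mk⇔ to from))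
  where
    max∉ : ∀ {τ} → τ ∈ perms n → suc n ∉ τ
    max∉ τ∈ = suc∉ n (∈-perms⁻ n τ∈)

    same-base : ∀ {τ τ′ σ} → τ ∈ perms n → τ′ ∈ perms n →
      σ ∈ insertions (suc n) τ → σ ∈ insertions (suc n) τ′ → τ ≡ τ′
    same-base {τ} {τ′} τ∈ τ′∈ σ∈ σ∈′
      with ∈-applyUpTo⁻ (λ i → insertAt i (suc n) τ) σ∈ | ∈-applyUpTo⁻ (λ j → insertAt j (suc n) τ′) σ∈′
    ... | i , i≤ , refl | j , j≤ , e =
      proj₂ (insertAt-injective τ τ′ (max∉ τ∈) (max∉ τ′∈) (≤-pred i≤) (≤-pred j≤) e)

    unique-insertions : Unique (concatMap (insertions (suc n)) (perms n))
    unique-insertions = Unique-concatMap⁺ (insertions (suc n)) (Unique-perms n)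
      (All.tabulate (λ τ∈ → Unique-insertions (suc n) _ (max∉ τ∈))) same-base

    to : ∀ {σ} → σ ∈ perms (suc n) → σ ∈ concatMap (insertions (suc n)) (perms n)
    to σ∈ with ↭oneTo-suc⇒insertAt n (∈-perms⁻ (suc n) σ∈)
    ... | i , τ , τ↭ , i≤ , refl =
      ∈-concatMap⁺ (insertions (suc n)) {xs = perms n} (lose (∈-perms⁺ n τ↭) (∈-insertions (suc n) τ i≤))

    from : ∀ {σ} → σ ∈ concatMap (insertions (suc n)) (perms n) → σ ∈ perms (suc n)
    from σ∈ with find (∈-concatMap⁻ (insertions (suc n)) {xs = perms n} σ∈)
    ... | τ , τ∈ , σ∈′ with ∈-applyUpTo⁻ (λ i → insertAt i (suc n) τ) σ∈′
    ... | i , _ , refl = ∈-perms⁺ (suc n) (insertAt-↭oneTo i n (∈-perms⁻ n τ∈))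

lastEntry : List ℕ → ℕ
lastEntry σ = fromMaybe 0 (last σ)

lastIs≡lastEntry : (x : ℕ) → 1 ≤ x → (σ : List ℕ) → lastIs x σ ≡ (lastEntry σ ≡ᵇ x)
lastIs≡lastEntry (suc x) _ σ with last σ
... | just y  = refl
... | nothing = refl

permStat : List ℕ → ℕ × ℕ
permStat σ = suc (specialDescents σ) , lastEntry σ

descentOrEnd : ℕ → List ℕ → Bool
descentOrEnd zero    (a ∷ b ∷ _) = b <ᵇ a
descentOrEnd zero    _           = true
descentOrEnd (suc i) []          = true
descentOrEnd (suc i) (_ ∷ σ)     = descentOrEnd i σ

-- insertionKeeps σ i: inserting a new maximum after the first i entries of σ creates no new
-- special descent.
insertionKeeps : List ℕ → ℕ → Bool
insertionKeeps []      zero    = true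
insertionKeeps (a ∷ _) zero    = a ≡ᵇ 1
insertionKeeps σ       (suc i) = descentOrEnd i σ

descentOrEnd-last : (a : ℕ) (σ : List ℕ) → descentOrEnd (length σ) (a ∷ σ) ≡ true
descentOrEnd-last a []      = refl
descentOrEnd-last a (b ∷ σ) = descentOrEnd-last b σ

count-descentOrEnd : (a : ℕ) (σ : List ℕ) →
  count (λ i → descentOrEnd i (a ∷ σ)) (upTo (length (a ∷ σ))) ≡ suc (descents (a ∷ σ))
count-descentOrEnd a []      = refl
count-descentOrEnd a (b ∷ σ) =
  trans (count-upTo-suc (λ i → descentOrEnd i (a ∷ b ∷ σ)) (length (b ∷ σ)))
        (trans (cong ((if b <ᵇ a then 1 else 0) +_) (count-descentOrEnd b σ)) (+-suc _ _))

count-insertionKeeps : (a : ℕ) (σ : List ℕ) →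
  count (insertionKeeps (a ∷ σ)) (upTo (suc (length (a ∷ σ)))) ≡ suc (specialDescents (a ∷ σ))
count-insertionKeeps a σ =
  trans (count-upTo-suc (insertionKeeps (a ∷ σ)) (length (a ∷ σ)))
        (trans (cong ((if a ≡ᵇ 1 then 1 else 0) +_) (count-descentOrEnd a σ)) (+-suc _ _))

descents-insertAt-suc : {m : ℕ} (i : ℕ) (τ : List ℕ) → All (_< m) τ → suc i ≤ length τ →
  descents (insertAt (suc i) m τ) ≡ (if descentOrEnd i τ then 0 else 1) + descents τ
descents-insertAt-suc zero (a ∷ []) (a<m ∷ _) _ rewrite <ᵇ-false a<m = refl
descents-insertAt-suc zero (a ∷ b ∷ σ) (a<m ∷ b<m ∷ _) _ rewrite <ᵇ-false a<m | <ᵇ-true b<m with b <ᵇ a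
... | true  = refl
... | false = refl
descents-insertAt-suc (suc i) (a ∷ b ∷ σ) (_ ∷ bσ<m) (s≤s i<) =
  trans (cong ((if b <ᵇ a then 1 else 0) +_) (descents-insertAt-suc i (b ∷ σ) bσ<m i<))
        (x∙yz≈y∙xz (if b <ᵇ a then 1 else 0) (if descentOrEnd i (b ∷ σ) then 0 else 1) (descents (b ∷ σ)))

specialDescents-insertAt : {m : ℕ} (i : ℕ) (τ : List ℕ) → 2 ≤ m → All (_< m) τ → i ≤ length τ →
  specialDescents (insertAt i m τ) ≡ (if insertionKeeps τ i then 0 else 1) + specialDescents τ
specialDescents-insertAt zero    []      (s≤s (s≤s _)) _ _ = refl
specialDescents-insertAt zero    (a ∷ σ) (s≤s (s≤s _)) (a<m ∷ _) _ rewrite <ᵇ-true a<m with a ≡ᵇ 1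
... | true  = refl
... | false = refl
specialDescents-insertAt (suc i) (a ∷ σ) _ τ<m i< =
  trans (cong ((if a ≡ᵇ 1 then 1 else 0) +_) (descents-insertAt-suc i (a ∷ σ) τ<m i<))
        (x∙yz≈y∙xz (if a ≡ᵇ 1 then 1 else 0) (if descentOrEnd i (a ∷ σ) then 0 else 1) (descents (a ∷ σ)))

last-∷-insertAt : (a i m : ℕ) (τ : List ℕ) → last (a ∷ insertAt i m τ) ≡ last (insertAt i m τ)
last-∷-insertAt a zero    m τ       = refl
last-∷-insertAt a (suc i) m []      = refl
last-∷-insertAt a (suc i) m (b ∷ τ) = refl

lastEntry-insertAt : {m : ℕ} (i : ℕ) (τ : List ℕ) → i < length τ → lastEntry (insertAt i m τ) ≡ lastEntry τ
lastEntry-insertAt zero    (a ∷ [])    _        = refl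
lastEntry-insertAt zero    (a ∷ b ∷ σ) _        = refl
lastEntry-insertAt {m} (suc i) (a ∷ b ∷ σ) (s≤s i<) =
  trans (cong (fromMaybe 0) (last-∷-insertAt a i m (b ∷ σ))) (lastEntry-insertAt i (b ∷ σ) i<)

lastEntry-insertAt-length : (m : ℕ) (τ : List ℕ) → lastEntry (insertAt (length τ) m τ) ≡ m
lastEntry-insertAt-length m []      = refl
lastEntry-insertAt-length m (a ∷ σ) =
  trans (cong (fromMaybe 0) (last-∷-insertAt a (length σ) m σ)) (lastEntry-insertAt-length m σ)

insertionKeeps-length : (τ : List ℕ) → insertionKeeps τ (length τ) ≡ true
insertionKeeps-length []      = refl
insertionKeeps-length (a ∷ σ) = descentOrEnd-last a σ

permStat-insertAt : {m : ℕ} (τ : List ℕ) → 2 ≤ m → All (_< m) τ → (i : ℕ) → i ≤ length τ →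
  let ℓ = suc (specialDescents τ) ; x = lastEntry τ in
  permStat (insertAt i m τ) ≡ classify (ℓ , m) (ℓ , x) (suc ℓ , x) (length τ) (insertionKeeps τ) i
permStat-insertAt {m} τ 2≤m τ<m i i≤ with i ≡ᵇ length τ in i≡?
... | true rewrite ≡ᵇ-true⇒≡ i (length τ) i≡? =
  cong₂ _,_ (cong suc (trans (specialDescents-insertAt (length τ) τ 2≤m τ<m ≤-refl)
                             (cong (λ b → (if b then 0 else 1) + specialDescents τ) (insertionKeeps-length τ))))
            (lastEntry-insertAt-length m τ)
... | false
  rewrite specialDescents-insertAt i τ 2≤m τ<m i≤
        | lastEntry-insertAt {m} i τ (≤∧≢⇒< i≤ λ i≡ → subst T i≡? (≡⇒≡ᵇ i (length τ) i≡))
  with insertionKeeps τ i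
... | true  = refl
... | false = refl

permStat-insertions↭offspring : (a : ℕ) (σ : List ℕ) → let m = suc (length (a ∷ σ)) in All (_< m) (a ∷ σ) →
  map permStat (insertions m (a ∷ σ)) ↭ offspring m (permStat (a ∷ σ))
permStat-insertions↭offspring a σ τ<m =
  ↭-trans (↭-reflexive (begin
    map permStat (applyUpTo (λ i → insertAt i m τ) m)       ≡⟨ cong (map permStat) (map-upTo _ m) ⟨
    map permStat (map (λ i → insertAt i m τ) (upTo m))      ≡⟨ map-∘ (upTo m) ⟨
    map (λ i → permStat (insertAt i m τ)) (upTo m)          ≡⟨ map-cong-local (All.tabulate slot) ⟩
    map (classify (ℓ , m) (ℓ , x) (suc ℓ , x) (length τ) (insertionKeeps τ)) (upTo m) ∎))
  (map-classify-upTo↭offspring m ℓ x (length τ) (insertionKeeps τ) ≤-refl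
     (insertionKeeps-length τ) (count-insertionKeeps a σ))
  where
    open ≡-Reasoning
    τ = a ∷ σ
    m = suc (length τ)
    ℓ = suc (specialDescents τ)
    x = lastEntry τ
    slot : ∀ {i} → i ∈ upTo m →
      permStat (insertAt i m τ) ≡ classify (ℓ , m) (ℓ , x) (suc ℓ , x) (length τ) (insertionKeeps τ) i
    slot {i} i∈ = permStat-insertAt τ (s≤s (s≤s z≤n)) τ<m i (≤-pred (∈-upTo⁻ i∈))

perms-step : (n : ℕ) →
  map permStat (perms (suc (suc n))) ↭ concatMap (offspring (suc (suc n))) (map permStat (perms (suc n)))
perms-step n = begin
  map permStat (perms (suc m))                               ↭⟨ map⁺ permStat (perms-suc↭ m) ⟩
  map permStat (concatMap (insertions (suc m)) (perms m))    ≡⟨ map-concatMap permStat (insertions (suc m)) (perms m) ⟩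
  concatMap (λ τ → map permStat (insertions (suc m) τ)) (perms m)
    ↭⟨ concatMap-cong-local (All.tabulate λ τ∈ → per-perm _ (∈-perms⁻ m τ∈)) ⟩
  concatMap (λ τ → offspring (suc m) (permStat τ)) (perms m)
    ≡⟨ concatMap-map (offspring (suc m)) permStat (perms m) ⟨
  concatMap (offspring (suc m)) (map permStat (perms m))     ∎
  where
    open PermutationReasoning
    m = suc n
    per-perm : (τ : List ℕ) → τ ↭ oneTo m →
      map permStat (insertions (suc m) τ) ↭ offspring (suc m) (permStat τ)
    per-perm []      τ↭ with () ← ↭-length τ↭
    per-perm (a ∷ σ) τ↭ =
      subst (λ k → map permStat (insertions (suc (suc k)) (a ∷ σ)) ↭ offspring (suc (suc k)) (permStat (a ∷ σ)))
        length-σ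
        (permStat-insertions↭offspring a σ
          (subst (λ k → All (_< suc (suc k)) (a ∷ σ)) (sym length-σ) (All-resp-↭ (↭-sym τ↭) (oneTo-< m))))
      where
        length-σ : length σ ≡ n
        length-σ = suc-injective (trans (↭-length τ↭) (length-applyUpTo suc m))

-- ParentsBelow k ps: ps lists the parents of the vertices k+1, k+2, …, each parent
-- smaller than its child; a recursive tree on n+1 vertices is a list with ParentsBelow 0.
ParentsBelow : ℕ → List ℕ → Set
ParentsBelow k []       = ⊤
ParentsBelow k (p ∷ ps) = p ≤ k × ParentsBelow (suc k) ps

ParentsBelow-∷ʳ : (k : ℕ) (ps : List ℕ) {p : ℕ} → ParentsBelow k ps → p ≤ k + length ps →
  ParentsBelow k (ps ++ [ p ])
ParentsBelow-∷ʳ k []       {p} _          p≤ = subst (p ≤_) (+-identityʳ k) p≤ , tt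
ParentsBelow-∷ʳ k (q ∷ ps) {p} (q≤ , ps≤) p≤ =
  q≤ , ParentsBelow-∷ʳ (suc k) ps ps≤ (subst (p ≤_) (+-suc k (length ps)) p≤)

ParentsBelow⇒< : (k : ℕ) (ps : List ℕ) → ParentsBelow k ps → All (_< k + length ps) ps
ParentsBelow⇒< k []       _          = []
ParentsBelow⇒< k (p ∷ ps) (p≤ , ps≤) =
  ≤-trans (s≤s p≤) (subst (suc k ≤_) (sym (+-suc k (length ps))) (s≤s (m≤m+n k _)))
  ∷ All.map (λ {a} → subst (a <_) (sym (+-suc k (length ps)))) (ParentsBelow⇒< (suc k) ps ps≤)

parentLists-valid : (m : ℕ) → All (λ ps → ParentsBelow 0 ps × length ps ≡ m) (parentLists m)
parentLists-valid zero    = (tt , refl) ∷ []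
parentLists-valid (suc m) = All.concat⁺ (All.map⁺ (All.map grafts (parentLists-valid m)))
  where
    grafts : ∀ {ps} → ParentsBelow 0 ps × length ps ≡ m →
      All (λ ps′ → ParentsBelow 0 ps′ × length ps′ ≡ suc m) (map (λ p → ps ++ [ p ]) (upTo (suc m)))
    grafts {ps} (valid , length-ps) = All.map⁺ (All.tabulate λ p∈ →
      ParentsBelow-∷ʳ 0 ps valid (subst (_ ≤_) (sym length-ps) (≤-pred (∈-upTo⁻ p∈))) ,
      trans (length-++ ps) (trans (+-comm (length ps) 1) (cong suc length-ps)))

smallestChildFrom-∷ʳ : (u : ℕ) (ps : List ℕ) (p v : ℕ) →
  smallestChildFrom u (ps ++ [ p ]) v
    ≡ (smallestChildFrom u ps v <∣> (if p ≡ᵇ v then just (u + length ps) else nothing))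
smallestChildFrom-∷ʳ u [] p v rewrite +-identityʳ u with p ≡ᵇ v
... | true  = refl
... | false = refl
smallestChildFrom-∷ʳ u (q ∷ ps) p v with q ≡ᵇ v
... | true  = refl
... | false rewrite +-suc u (length ps) = smallestChildFrom-∷ʳ (suc u) ps p v

smallestChildFrom-bound : (k : ℕ) (ps : List ℕ) {v w : ℕ} → ParentsBelow k ps →
  smallestChildFrom (suc k) ps v ≡ just w → v < w × w ≤ k + length ps
smallestChildFrom-bound k (p ∷ ps) {v} {w} (p≤ , ps≤) found with p ≡ᵇ v in p≡?v
... | true with refl ← found =
  subst (_< suc k) (≡ᵇ-true⇒≡ p v p≡?v) (s≤s p≤) ,
  subst (suc k ≤_) (sym (+-suc k (length ps))) (s≤s (m≤m+n k _))
... | false with v<w , w≤ ← smallestChildFrom-bound (suc k) ps ps≤ found =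
  v<w , subst (w ≤_) (sym (+-suc k (length ps))) w≤

smallestChildFrom-childless : (u : ℕ) (ps : List ℕ) {v : ℕ} → All (_< v) ps → smallestChildFrom u ps v ≡ nothing
smallestChildFrom-childless u []       []           = refl
smallestChildFrom-childless u (p ∷ ps) (p<v ∷ ps<v)
  rewrite <⇒≡ᵇ-false p<v = smallestChildFrom-childless (suc u) ps ps<v

smallestChildFrom-nothing : (u : ℕ) (ps : List ℕ) {v : ℕ} → smallestChildFrom u ps v ≡ nothing →
  count (_≡ᵇ v) ps ≡ 0
smallestChildFrom-nothing u []       none = refl
smallestChildFrom-nothing u (p ∷ ps) {v} none with p ≡ᵇ v
... | false = smallestChildFrom-nothing (suc u) ps none

children-∷ʳ : (ps : List ℕ) (p v : ℕ) → children (ps ++ [ p ]) v ≡ (if p ≡ᵇ v then 1 else 0) + children ps v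
children-∷ʳ ps p v = begin
  children (ps ++ [ p ]) v                               ≡⟨ countᵇ≡count (_≡ᵇ v) (ps ++ [ p ]) ⟩
  count (_≡ᵇ v) (ps ++ [ p ])                            ≡⟨ count-++ (_≡ᵇ v) ps [ p ] ⟩
  count (_≡ᵇ v) ps + ((if p ≡ᵇ v then 1 else 0) + 0)     ≡⟨ +-comm (count (_≡ᵇ v) ps) _ ⟩
  (if p ≡ᵇ v then 1 else 0) + 0 + count (_≡ᵇ v) ps
    ≡⟨ cong₂ _+_ (+-identityʳ _) (sym (countᵇ≡count (_≡ᵇ v) ps)) ⟩
  (if p ≡ᵇ v then 1 else 0) + children ps v              ∎
  where open ≡-Reasoning

degree-∷ʳ : (ps : List ℕ) (p v : ℕ) → degree (ps ++ [ p ]) v ≡ (if p ≡ᵇ v then 1 else 0) + degree ps v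
degree-∷ʳ ps p zero    = children-∷ʳ ps p zero
degree-∷ʳ ps p (suc v) = trans (cong suc (children-∷ʳ ps p (suc v))) (sym (+-suc _ _))

pathEnd-leaf : (f : ℕ) (ps : List ℕ) {v : ℕ} → smallestChild ps v ≡ nothing → pathEnd f ps v ≡ v
pathEnd-leaf zero    ps none = refl
pathEnd-leaf (suc f) ps none rewrite none = refl

pathEnd-step : (f : ℕ) (ps : List ℕ) {v u : ℕ} → smallestChild ps v ≡ just u →
  pathEnd (suc f) ps v ≡ pathEnd f ps u
pathEnd-step f ps found rewrite found = refl

root-child : (ps : List ℕ) → ParentsBelow 0 ps → 1 ≤ length ps → smallestChild ps 0 ≡ just 1
root-child (p₀ ∷ _) (p₀≤0 , _) _ rewrite n≤0⇒n≡0 p₀≤0 = refl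

degree-root-positive : (ps : List ℕ) → ParentsBelow 0 ps → 1 ≤ length ps → 1 ≤ degree ps 0
degree-root-positive (p₀ ∷ _) (p₀≤0 , _) _ rewrite n≤0⇒n≡0 p₀≤0 = s≤s z≤n

treeStat : ℕ → List ℕ → ℕ × ℕ
treeStat N ps = leaves N ps , smallestPathEnd N ps

module RecursiveTree (ps : List ℕ) (valid : ParentsBelow 0 ps) where

  n : ℕ
  n = length ps

  smallestChild-bound : {v u : ℕ} → smallestChild ps v ≡ just u → v < u × u ≤ n
  smallestChild-bound = smallestChildFrom-bound 0 ps valid

  smallestChild-beyond : {v : ℕ} → n ≤ v → smallestChild ps v ≡ nothing
  smallestChild-beyond {v} n≤v with smallestChild ps v in v-child
  ... | nothing = refl
  ... | just u  = let v<u , u≤n = smallestChild-bound v-child in contradiction (≤-trans u≤n n≤v) (<⇒≱ v<u)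

  fuel-step : {f v u : ℕ} → n ≤ v + suc f → v < u → n ≤ u + f
  fuel-step {f} {v} fuel v<u = ≤-trans (subst (n ≤_) (+-suc v f) fuel) (+-monoˡ-≤ f v<u)

  -- Labels increase along the path, so fuel n ∸ v suffices to reach its end.
  pathEnd-childless : (f v : ℕ) → n ≤ v + f → v ≤ n →
    v ≤ pathEnd f ps v × pathEnd f ps v ≤ n × smallestChild ps (pathEnd f ps v) ≡ nothing
  pathEnd-childless f v fuel v≤n with smallestChild ps v in v-child
  ... | nothing rewrite pathEnd-leaf f ps v-child = ≤-refl , v≤n , v-child
  pathEnd-childless zero v fuel v≤n | just u
    with () ← trans (sym v-child) (smallestChild-beyond (subst (n ≤_) (+-identityʳ v) fuel))
  pathEnd-childless (suc f) v fuel v≤n | just u rewrite pathEnd-step f ps v-child =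
    let v<u , u≤n = smallestChild-bound v-child
        u≤e , e≤n , e-childless = pathEnd-childless f u (fuel-step fuel v<u) u≤n
    in ≤-trans (<⇒≤ v<u) u≤e , e≤n , e-childless

  module Graft (p : ℕ) (p≤n : p ≤ n) where

    ps′ : List ℕ
    ps′ = ps ++ [ p ]

    ps′<new : All (_< suc n) ps′
    ps′<new = All.++⁺ (All.map m≤n⇒m≤1+n (ParentsBelow⇒< 0 ps valid)) (s≤s p≤n ∷ [])

    smallestChild-∷ʳ-just : {v u : ℕ} → smallestChild ps v ≡ just u → smallestChild ps′ v ≡ just u
    smallestChild-∷ʳ-just {v} found rewrite smallestChildFrom-∷ʳ 1 ps p v | found = refl

    pathEnd-∷ʳ : (f v : ℕ) → n ≤ v + f →
      pathEnd (suc f) ps′ v ≡ (if p ≡ᵇ pathEnd f ps v then suc n else pathEnd f ps v)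
    pathEnd-∷ʳ f v fuel with smallestChild ps v in v-child
    ... | nothing rewrite pathEnd-leaf f ps v-child | smallestChildFrom-∷ʳ 1 ps p v | v-child with p ≡ᵇ v
    ...   | true  = pathEnd-leaf f ps′ (smallestChildFrom-childless 1 ps′ ps′<new)
    ...   | false = refl
    pathEnd-∷ʳ zero v fuel | just u
      with () ← trans (sym v-child) (smallestChild-beyond (subst (n ≤_) (+-identityʳ v) fuel))
    pathEnd-∷ʳ (suc f) v fuel | just u
      rewrite pathEnd-step (suc f) ps′ (smallestChild-∷ʳ-just v-child) | pathEnd-step f ps v-child =
      pathEnd-∷ʳ f u (fuel-step fuel (proj₁ (smallestChild-bound v-child)))

    degree-new-vertex : degree ps′ (suc n) ≡ 1
    degree-new-vertex = cong suc (trans (countᵇ≡count (_≡ᵇ suc n) ps′) (count-≡ᵇ-absent (suc n) ps′ ps′<new))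

  isLeaf : ℕ → Bool
  isLeaf v = degree ps v ≡ᵇ 1

  ℓ : ℕ
  ℓ = leaves (suc n) ps

  end : ℕ
  end = smallestPathEnd (suc n) ps

  module _ (nonempty : 1 ≤ n) where

    degree-positive : (v : ℕ) → 1 ≤ degree ps v
    degree-positive zero    = degree-root-positive ps valid nonempty
    degree-positive (suc v) = s≤s z≤n

    end-facts : 1 ≤ end × end ≤ n × smallestChild ps end ≡ nothing
    end-facts rewrite pathEnd-step n ps (root-child ps valid nonempty) = pathEnd-childless n 1 (n≤1+n n) nonempty

    isLeaf-end : isLeaf end ≡ true
    isLeaf-end with end | end-facts
    ... | suc x | _ , _ , childless
      rewrite countᵇ≡count (_≡ᵇ suc x) ps | smallestChildFrom-nothing 1 ps childless = refl

    module _ (p : ℕ) (p≤n : p ≤ n) where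
      open Graft p p≤n

      isLeaf-after-graft : (v : ℕ) → (degree ps′ v ≡ᵇ 1) ≡ (not (v ≡ᵇ p) ∧ isLeaf v)
      isLeaf-after-graft v = begin
        degree ps′ v ≡ᵇ 1                             ≡⟨ cong (_≡ᵇ 1) (degree-∷ʳ ps p v) ⟩
        (if p ≡ᵇ v then 1 else 0) + degree ps v ≡ᵇ 1  ≡⟨ ≡ᵇ1-after-increment (p ≡ᵇ v) (degree ps v) (degree-positive v) ⟩
        not (p ≡ᵇ v) ∧ isLeaf v                       ≡⟨ cong (λ b → not b ∧ isLeaf v) (≡ᵇ-sym p v) ⟩
        not (v ≡ᵇ p) ∧ isLeaf v                       ∎
        where open ≡-Reasoning

      otherLeaves : ℕ
      otherLeaves = count (λ v → not (v ≡ᵇ p) ∧ isLeaf v) (upTo (suc n))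

      leaves-∷ʳ-split : leaves (suc (suc n)) ps′ ≡ otherLeaves + 1
      leaves-∷ʳ-split = begin
        leaves (suc (suc n)) ps′
          ≡⟨ countᵇ≡count isLeaf′ (upTo (suc (suc n))) ⟩
        count isLeaf′ (upTo (suc (suc n)))
          ≡⟨ cong (count isLeaf′) (upTo-∷ʳ (suc n)) ⟨
        count isLeaf′ (upTo (suc n) ++ [ suc n ])
          ≡⟨ count-++ isLeaf′ (upTo (suc n)) [ suc n ] ⟩
        count isLeaf′ (upTo (suc n)) + ((if degree ps′ (suc n) ≡ᵇ 1 then 1 else 0) + 0)
          ≡⟨ cong₂ _+_ (count-cong isLeaf-after-graft (upTo (suc n)))
                       (cong (λ d → (if d ≡ᵇ 1 then 1 else 0) + 0) degree-new-vertex) ⟩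
        otherLeaves + 1
          ∎
        where
          open ≡-Reasoning
          isLeaf′ : ℕ → Bool
          isLeaf′ v = degree ps′ v ≡ᵇ 1

      otherLeaves+p : otherLeaves + (if isLeaf p then 1 else 0) ≡ ℓ
      otherLeaves+p = trans (count-avoiding-once p isLeaf (upTo (suc n)) (count-upTo-≡ᵇ p (suc n) (s≤s p≤n)))
                            (sym (countᵇ≡count isLeaf (upTo (suc n))))

      leaves-∷ʳ : leaves (suc (suc n)) ps′ ≡ (if isLeaf p then ℓ else suc ℓ)
      leaves-∷ʳ with isLeaf p | otherLeaves+p
      ... | true  | others+1≡ℓ = trans leaves-∷ʳ-split others+1≡ℓ
      ... | false | others+0≡ℓ =
        trans leaves-∷ʳ-split
          (trans (+-comm otherLeaves 1) (cong suc (trans (sym (+-identityʳ otherLeaves)) others+0≡ℓ)))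

      treeStat-∷ʳ : treeStat (suc (suc n)) ps′ ≡ classify (ℓ , suc n) (ℓ , end) (suc ℓ , end) end isLeaf p
      treeStat-∷ʳ rewrite leaves-∷ʳ | pathEnd-∷ʳ (suc n) 0 (n≤1+n n) with p ≡ᵇ end in p≡?end
      ... | true rewrite ≡ᵇ-true⇒≡ p end p≡?end | isLeaf-end = refl
      ... | false with isLeaf p
      ...   | true  = refl
      ...   | false = refl

    treeStat-grafts↭offspring :
      map (treeStat (suc (suc n))) (map (λ p → ps ++ [ p ]) (upTo (suc n))) ↭ offspring (suc n) (treeStat (suc n) ps)
    treeStat-grafts↭offspring =
      ↭-trans (↭-reflexive (trans (sym (map-∘ (upTo (suc n))))
                                  (map-cong-local (All.tabulate λ p∈ → treeStat-∷ʳ _ (≤-pred (∈-upTo⁻ p∈))))))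
              (map-classify-upTo↭offspring (suc n) ℓ end end isLeaf (s≤s (proj₁ (proj₂ end-facts))) isLeaf-end
                (sym (countᵇ≡count isLeaf (upTo (suc n)))))

trees-step : (k : ℕ) →
  map (treeStat (suc (suc (suc k)))) (parentLists (suc (suc k)))
    ↭ concatMap (offspring (suc (suc k))) (map (treeStat (suc (suc k))) (parentLists (suc k)))
trees-step k = begin
  map (treeStat (suc (suc (suc k)))) (concatMap grafts (parentLists (suc k)))
    ≡⟨ map-concatMap (treeStat (suc (suc (suc k)))) grafts (parentLists (suc k)) ⟩
  concatMap (λ ps → map (treeStat (suc (suc (suc k)))) (grafts ps)) (parentLists (suc k))
    ↭⟨ concatMap-cong-local (All.map per-tree (parentLists-valid (suc k))) ⟩
  concatMap (λ ps → offspring (suc (suc k)) (treeStat (suc (suc k)) ps)) (parentLists (suc k))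
    ≡⟨ concatMap-map (offspring (suc (suc k))) (treeStat (suc (suc k))) (parentLists (suc k)) ⟨
  concatMap (offspring (suc (suc k))) (map (treeStat (suc (suc k))) (parentLists (suc k)))
    ∎
  where
    open PermutationReasoning
    grafts : List ℕ → List (List ℕ)
    grafts ps = map (λ p → ps ++ [ p ]) (upTo (suc (suc k)))
    per-tree : ∀ {ps} → ParentsBelow 0 ps × length ps ≡ suc k →
      map (treeStat (suc (suc (suc k)))) (grafts ps) ↭ offspring (suc (suc k)) (treeStat (suc (suc k)) ps)
    per-tree {ps} (valid , length-ps) =
      subst (λ n → map (treeStat (suc (suc n))) (map (λ p → ps ++ [ p ]) (upTo (suc n)))
                     ↭ offspring (suc n) (treeStat (suc n) ps))
        length-ps (RecursiveTree.treeStat-grafts↭offspring ps valid (subst (1 ≤_) (sym length-ps) (s≤s z≤n)))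

permStat↭treeStat : (k : ℕ) → map permStat (perms (suc k)) ↭ map (treeStat (suc (suc k))) (parentLists (suc k))
permStat↭treeStat = ↭-of-same-rule (λ k → offspring (suc (suc k)))
  (λ k → map permStat (perms (suc k))) (λ k → map (treeStat (suc (suc k))) (parentLists (suc k)))
  ↭-refl perms-step trees-step

≡-1⇔suc≡ : (i ℓ : ℤ) → (i ≡ ℓ ℤ.- ℤ.1ℤ) ⇔ (ℤ.suc i ≡ ℓ)
≡-1⇔suc≡ i ℓ = mk⇔
  (λ e → trans (cong ℤ.suc (trans e (ℤ.+-comm ℓ (ℤ.- ℤ.1ℤ)))) (ℤ.suc-pred ℓ))
  (λ e → trans (sym (ℤ.pred-suc i)) (trans (cong ℤ.pred e) (ℤ.+-comm (ℤ.- ℤ.1ℤ) ℓ)))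

≡ℤᵇ-pred : (i ℓ : ℤ) → (i ≡ℤᵇ (ℓ ℤ.- ℤ.1ℤ)) ≡ (ℤ.suc i ≡ℤᵇ ℓ)
≡ℤᵇ-pred i ℓ = begin
  isYes (i ℤ.≟ ℓ ℤ.- ℤ.1ℤ)  ≡⟨ isYes≗does (i ℤ.≟ ℓ ℤ.- ℤ.1ℤ) ⟩
  does (i ℤ.≟ ℓ ℤ.- ℤ.1ℤ)   ≡⟨ does-⇔ (≡-1⇔suc≡ i ℓ) (i ℤ.≟ ℓ ℤ.- ℤ.1ℤ) (ℤ.suc i ℤ.≟ ℓ) ⟩
  does (ℤ.suc i ℤ.≟ ℓ)      ≡⟨ isYes≗does (ℤ.suc i ℤ.≟ ℓ) ⟨
  isYes (ℤ.suc i ℤ.≟ ℓ)     ∎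
  where open ≡-Reasoning

lemma8p2 : (N : ℕ) (ℓ : ℤ) (x : ℕ) → 2 ≤ N → 1 ≤ x → x ≤ N ∸ 1 →
    permCount (N ∸ 1) ℓ x ≡ R N ℓ x
lemma8p2 (suc zero)    ℓ x (s≤s ())
lemma8p2 (suc (suc k)) ℓ x _ 1≤x _ = begin
  permCount (suc k) ℓ x
    ≡⟨ countᵇ≡count _ (perms (suc k)) ⟩
  count (λ σ → ((ℤ.+ specialDescents σ) ≡ℤᵇ (ℓ ℤ.- ℤ.1ℤ)) ∧ lastIs x σ) (perms (suc k))
    ≡⟨ count-cong (λ σ → cong₂ _∧_ (≡ℤᵇ-pred (ℤ.+ specialDescents σ) ℓ) (lastIs≡lastEntry x 1≤x σ))
                  (perms (suc k)) ⟩
  count (λ σ → wanted (permStat σ)) (perms (suc k))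
    ≡⟨ count-map wanted permStat (perms (suc k)) ⟨
  count wanted (map permStat (perms (suc k)))
    ≡⟨ count-↭ wanted (permStat↭treeStat k) ⟩
  count wanted (map (treeStat (suc (suc k))) (parentLists (suc k)))
    ≡⟨ count-map wanted (treeStat (suc (suc k))) (parentLists (suc k)) ⟩
  count (λ ps → wanted (treeStat (suc (suc k)) ps)) (parentLists (suc k))
    ≡⟨ countᵇ≡count _ (parentLists (suc k)) ⟨
  R (suc (suc k)) ℓ x
    ∎
  where
    open ≡-Reasoning
    wanted : ℕ × ℕ → Bool
    wanted (a , b) = ((ℤ.+ a) ≡ℤᵇ ℓ) ∧ (b ≡ᵇ x)
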